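{- Let $n\geq 0$. For every word $v\in\{a,b\}^n$ one has $$|\psi(v)|\leq|\psi(v^{(n)})|,$$ and equality holds if and only if $v=v^{(n)}$ or $v=E(v^{(n)})$.
   Context: Let $\mathcal{A}=\{a,b\}$, let $\mathcal{A}^*$ be the free monoid over $\mathcal{A}$ with empty word $\varepsilon$, and let $\mathcal{A}^n$ denote the set of words of length $n$. For a word $w$, $w^{(+)}$ denotes the shortest palindrome having $w$ as a prefix. The palindromization map $\psi:\mathcal{A}^*\to\mathcal{A}^*$ is defined by $\psi(\varepsilon)=\varepsilon$ and $\psi(vx)=(\psi(v)x)^{(+)}$ for $v\in\mathcal{A}^*$, $x\in\mathcal{A}$. For $n\geq 0$, $v^{(n)}$ denotes the prefix of length $n$ of the infinite word $(ab)^\omega=abab\cdots$. $E$ is the automorphism of $\mathcal{A}^*$ with $E(a)=b$, $E(b)=a$. -}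

module Defs where

open import Data.Nat using (ℕ; zero; suc; _+_; _∸_)
open import Data.List using (List; []; _∷_; _++_; reverse; take; length)
open import Data.Bool using (Bool; true; false; if_then_else_)
open import Relation.Nullary using (yes; no; does)
open import Relation.Binary.PropositionalEquality using (_≡_; refl)
open import Relation.Binary.Definitions using (DecidableEquality)
import Data.List.Properties as LP

data Letter : Set where
  a b : Letter

_≟L_ : DecidableEquality Letter
a ≟L a = yes refl
a ≟L b = no λ ()
b ≟L a = no λ ()
b ≟L b = yes refl

Word : Set
Word = List Letter

_≟W_ : DecidableEquality Word
_≟W_ = LP.≡-dec _≟L_

isPal : Word → Bool
isPal w = does (w ≟W reverse w)

-- w^(+): the shortest palindrome having w as a prefix.
-- Every word of length |w| + k having w as prefix and being a palindrome
-- equals w ++ reverse (take k w); so we search k = 0, 1, ..., |w| for the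
-- least k such that w ++ reverse (take k w) is a palindrome (k = |w| always works).
palClosure : Word → Word
palClosure w = go 0 (length w)
  where
  go : ℕ → ℕ → Word
  go k zero = w ++ reverse (take k w)
  go k (suc fuel) =
    if isPal (w ++ reverse (take k w)) then w ++ reverse (take k w) else go (suc k) fuel

-- palindromization map ψ: ψ(ε) = ε, ψ(vx) = (ψ(v)x)^(+)
-- (defined on reversed words to recurse on the last letter)
ψ-rev : Word → Word
ψ-rev [] = []
ψ-rev (x ∷ rv) = palClosure (ψ-rev rv ++ (x ∷ []))

ψ : Word → Word
ψ v = ψ-rev (reverse v)

swapL : Letter → Letter
swapL a = b
swapL b = a

E : Word → Word
E = Data.List.map swapL

altFrom : Letter → ℕ → Word
altFrom x zero = []
altFrom x (suc n) = x ∷ altFrom (swapL x) n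

vpref : ℕ → Word
vpref n = altFrom a n

{-# OPTIONS --safe #-}
module Submission where

-- Write r for the reversal of v, so that ψ v = ψ-rev r. The palindromic prefixes of ψ-rev r are the
-- ψ-rev s for the suffixes s of r, so the palindromic closure of ψ-rev r ++ [x] is governed by the
-- first occurrence r = t ++ x ∷ s of x (Justin's formula): |ψ-rev (x ∷ r)| = 2|ψ-rev r| - |ψ-rev s|,
-- and 2|ψ-rev r| + 1 when x does not occur in r. Tracking the quantities |ψ-rev s| + 2 for both
-- letters gives |ψ v| + 2 = A + B, where (A, B) starts at (1, 1) and reading a (resp. b) replaces
-- B (resp. A) by A + B. This sum is maximal exactly when the smaller entry is always the one
-- replaced, that is, for the alternating words v⁽ⁿ⁾ and E(v⁽ⁿ⁾).

open import Defs
open import Data.Nat using (ℕ; zero; suc; _+_; _⊓_; _≤_; _<_; _≤?_; z≤n; s≤s; s≤s⁻¹)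
open import Data.Nat.Properties
open import Data.Nat.Tactic.RingSolver using (solve)
open import Data.List using (List; []; _∷_; _++_; reverse; take; length; foldl; foldr)
import Data.List.Properties as LP
open import Data.List.Membership.Propositional using (_∈_; _∉_)
open import Data.List.Membership.Propositional.Properties using (∈-++⁺ʳ)
open import Data.List.Relation.Unary.Any using (here; there)
open import Data.Product using (∃; ∃₂; _×_; _,_)
open import Data.Sum using (_⊎_; inj₁; inj₂)
open import Data.Bool using (if_then_else_)
open import Function using (_∘_; flip)
open import Function.Bundles using (_⇔_; mk⇔)
open import Relation.Nullary using (¬_; yes; no; does; contradiction)
open import Relation.Binary.PropositionalEquality

module _ {A : Set} where

  Palindrome : List A → Set
  Palindrome w = reverse w ≡ w

  reverse-∷-++ : ∀ (x : A) xs ys → reverse (x ∷ xs) ++ ys ≡ reverse xs ++ x ∷ ys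
  reverse-∷-++ x xs ys = trans (sym (LP.ʳ++-defn (x ∷ xs))) (LP.ʳ++-defn xs)

  reverse-++-∷ : ∀ (x : A) xs ys → reverse (xs ++ x ∷ ys) ≡ reverse ys ++ x ∷ reverse xs
  reverse-++-∷ x xs ys = trans (LP.reverse-++ xs (x ∷ ys)) (reverse-∷-++ x ys (reverse xs))

  ++-≡⇒prefix : ∀ (xs ys zs ws : List A) → xs ++ ys ≡ zs ++ ws → length zs ≤ length xs →
                ∃ λ g → xs ≡ zs ++ g
  ++-≡⇒prefix xs       ys []       ws eq z≤n       = xs , refl
  ++-≡⇒prefix (x ∷ xs) ys (z ∷ zs) ws eq (s≤s len) with LP.∷-injective eq
  ... | refl , eq′ with ++-≡⇒prefix xs ys zs ws eq′ len
  ...   | g , refl = g , refl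

  ++-length-≤⇒[] : ∀ (xs : List A) {ys} → length (xs ++ ys) ≤ length xs → ys ≡ []
  ++-length-≤⇒[] xs {[]}     _  = refl
  ++-length-≤⇒[] xs {y ∷ ys} le =
    contradiction (≤-trans (≤-reflexive (sym (LP.length-++ xs))) le) (m+1+n≰m (length xs))

  length-split : ∀ {xs} ys (y : A) zs → xs ≡ ys ++ y ∷ zs → length xs ≡ length ys + suc (length zs)
  length-split ys y zs refl = LP.length-++ ys

  ∉-∷⁺ : ∀ {x y : A} {t} → x ≢ y → x ∉ t → x ∉ y ∷ t
  ∉-∷⁺ x≢y x∉t (here x≡y)  = x≢y x≡y
  ∉-∷⁺ x≢y x∉t (there x∈t) = x∉t x∈t

  ∉-suffix-of-first : ∀ {x : A} t {s} t′ {s′} → x ∉ t → t ++ x ∷ s ≡ t′ ++ x ∷ s′ →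
                      ∃ λ u → s ≡ u ++ s′
  ∉-suffix-of-first []      []       x∉t eq = [] , LP.∷-injectiveʳ eq
  ∉-suffix-of-first {x} [] {s} (y ∷ t′) {s′} x∉t eq =
    t′ ++ x ∷ [] , trans (LP.∷-injectiveʳ eq) (sym (LP.++-assoc t′ (x ∷ []) s′))
  ∉-suffix-of-first (y ∷ t) []       x∉t eq = contradiction (here (sym (LP.∷-injectiveˡ eq))) x∉t
  ∉-suffix-of-first (y ∷ t) (_ ∷ t′) x∉t eq = ∉-suffix-of-first t t′ (x∉t ∘ there) (LP.∷-injectiveʳ eq)

  palindrome-++-reverse : ∀ w → Palindrome (w ++ reverse w)
  palindrome-++-reverse w =
    trans (LP.reverse-++ w (reverse w)) (cong (_++ reverse w) (LP.reverse-involutive w))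

  palindrome-mirror : ∀ (x : A) {p} → Palindrome p → Palindrome (p ++ x ∷ p)
  palindrome-mirror x {p} pal = trans (reverse-++-∷ x p p) (cong (λ q → q ++ x ∷ q) pal)

  palindrome-repeat : ∀ (x : A) {g z} → Palindrome g → Palindrome (g ++ x ∷ z) →
                      Palindrome ((g ++ x ∷ z) ++ x ∷ z)
  palindrome-repeat x {g} {z} palg palq = begin
    reverse (q ++ x ∷ z)        ≡⟨ reverse-++-∷ x q z ⟩
    reverse z ++ x ∷ reverse q  ≡⟨ cong (λ u → reverse z ++ x ∷ u) palq ⟩
    reverse z ++ x ∷ q          ≡⟨ LP.++-assoc (reverse z) (x ∷ g) (x ∷ z) ⟨
    (reverse z ++ x ∷ g) ++ x ∷ z ≡⟨ cong (_++ x ∷ z) reverse-q ⟨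
    reverse q ++ x ∷ z          ≡⟨ cong (_++ x ∷ z) palq ⟩
    q ++ x ∷ z                  ∎
    where
    open ≡-Reasoning
    q = g ++ x ∷ z
    reverse-q : reverse q ≡ reverse z ++ x ∷ g
    reverse-q = trans (reverse-++-∷ x g z) (cong (λ u → reverse z ++ x ∷ u) palg)

  take-length-++ : ∀ (xs ys : List A) → take (length xs) (xs ++ ys) ≡ xs
  take-length-++ []       ys = refl
  take-length-++ (x ∷ xs) ys = cong (x ∷_) (take-length-++ xs ys)

  palindrome-extension-mirrored : ∀ (x : A) {p e} → Palindrome p → Palindrome (p ++ x ∷ e) →
                                  p ++ x ∷ e ≡ reverse (x ∷ e) ++ p
  palindrome-extension-mirrored x {p} {e} palp pal = begin
    p ++ x ∷ e                 ≡⟨ pal ⟨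
    reverse (p ++ x ∷ e)       ≡⟨ reverse-++-∷ x p e ⟩
    reverse e ++ x ∷ reverse p ≡⟨ cong (λ u → reverse e ++ x ∷ u) palp ⟩
    reverse e ++ x ∷ p         ≡⟨ reverse-∷-++ x e p ⟨
    reverse (x ∷ e) ++ p       ∎
    where open ≡-Reasoning

  palindrome-short-extension : ∀ (x : A) {p e} → Palindrome p → Palindrome (p ++ x ∷ e) →
                               length e < length p → ∃ λ g → Palindrome g × p ≡ g ++ x ∷ e
  palindrome-short-extension x {p} {e} palp pal lt
    with ++-≡⇒prefix p (x ∷ e) (reverse (x ∷ e)) p (palindrome-extension-mirrored x palp pal)
           (≤-trans (≤-reflexive (LP.length-reverse (x ∷ e))) lt)
  ... | g , refl = g , palg , sym g++xe≡p
    where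
    g++xe≡p : g ++ x ∷ e ≡ reverse (x ∷ e) ++ g
    g++xe≡p = LP.++-cancelˡ (reverse (x ∷ e)) _ _
      (trans (sym (LP.++-assoc (reverse (x ∷ e)) g (x ∷ e))) (palindrome-extension-mirrored x palp pal))
    palg : Palindrome g
    palg = LP.++-cancelʳ (x ∷ e) (reverse g) g (begin
      reverse g ++ x ∷ e                       ≡⟨ cong (reverse g ++_) (LP.reverse-involutive (x ∷ e)) ⟨
      reverse g ++ reverse (reverse (x ∷ e))   ≡⟨ LP.reverse-++ (reverse (x ∷ e)) g ⟨
      reverse (reverse (x ∷ e) ++ g)           ≡⟨ palp ⟩
      reverse (x ∷ e) ++ g                     ≡⟨ g++xe≡p ⟨
      g ++ x ∷ e                               ∎)
      where open ≡-Reasoning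

  palindrome-suffix-mirrors-prefix : ∀ u s → Palindrome (u ++ s) → length s ≤ length u →
                                     s ≡ reverse (take (length s) u)
  palindrome-suffix-mirrors-prefix u s pal len
    with ++-≡⇒prefix u s (reverse s) (reverse u) (trans (sym pal) (LP.reverse-++ u s))
           (≤-trans (≤-reflexive (LP.length-reverse s)) len)
  ... | g , refl = begin
    s                                          ≡⟨ LP.reverse-involutive s ⟨
    reverse (reverse s)                        ≡⟨ cong reverse (take-length-++ (reverse s) g) ⟨
    reverse (take (length (reverse s)) u′)     ≡⟨ cong (λ k → reverse (take k u′)) (LP.length-reverse s) ⟩
    reverse (take (length s) u′)               ∎
    where
    open ≡-Reasoning
    u′ = reverse s ++ g

candidate : Word → ℕ → Word
candidate w k = w ++ reverse (take k w)

-- The local search loop of palClosure, which cannot be named outside Defs.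
closureSearch : Word → ℕ → ℕ → Word
closureSearch w k zero       = candidate w k
closureSearch w k (suc fuel) =
  if isPal (candidate w k) then candidate w k else closureSearch w (suc k) fuel

closureSearch-unique : ∀ w {loop : ℕ → ℕ → Word} →
  (∀ k → loop k zero ≡ candidate w k) →
  (∀ k n → loop k (suc n) ≡ (if isPal (candidate w k) then candidate w k else loop (suc k) n)) →
  ∀ k n → loop k n ≡ closureSearch w k n
closureSearch-unique w base next k zero    = base k
closureSearch-unique w {loop} base next k (suc n) =
  trans (next k n) (cong (λ u → if isPal (candidate w k) then candidate w k else u)
                         (closureSearch-unique w {loop} base next (suc k) n))

-- The loop is found by unification, which needs 0 and length w abstracted first.
palClosure≡closureSearch : ∀ w → palClosure w ≡ closureSearch w 0 (length w)
palClosure≡closureSearch w with closureSearch-unique w {_} | 0 | length w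
... | unique | k | n = unique (λ _ → refl) (λ _ _ → refl) k n

palindrome-candidate-length : ∀ w → Palindrome (candidate w (length w))
palindrome-candidate-length w =
  subst (λ t → Palindrome (w ++ reverse t)) (sym (LP.take-all (length w) w ≤-refl))
        (palindrome-++-reverse w)

length-candidate : ∀ w {k m} → k ≤ m → length (candidate w k) ≤ length w + m
length-candidate w {k} {m} k≤m = begin
  length (w ++ reverse (take k w))     ≡⟨ LP.length-++ w ⟩
  length w + length (reverse (take k w)) ≡⟨ cong (length w +_) (LP.length-reverse (take k w)) ⟩
  length w + length (take k w)         ≡⟨ cong (length w +_) (LP.length-take k w) ⟩
  length w + (k ⊓ length w)            ≤⟨ +-monoʳ-≤ (length w) (≤-trans (m⊓n≤m k (length w)) k≤m) ⟩
  length w + m                         ∎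
  where open ≤-Reasoning

closureSearch-palindrome : ∀ w k n → k + n ≡ length w → Palindrome (closureSearch w k n)
closureSearch-palindrome w k zero eq
  rewrite +-identityʳ k | eq = palindrome-candidate-length w
closureSearch-palindrome w k (suc n) eq with candidate w k ≟W reverse (candidate w k)
... | yes pal = sym pal
... | no _    = closureSearch-palindrome w (suc k) n (trans (sym (+-suc k n)) eq)

closureSearch-extends : ∀ w k n → ∃ λ e → closureSearch w k n ≡ w ++ e
closureSearch-extends w k zero = _ , refl
closureSearch-extends w k (suc n) with candidate w k ≟W reverse (candidate w k)
... | yes _ = _ , refl
... | no _  = closureSearch-extends w (suc k) n

closureSearch-shortest : ∀ w k n {m} → k ≤ m → Palindrome (candidate w m) →
                         length (closureSearch w k n) ≤ length w + m
closureSearch-shortest w k zero    k≤m pal = length-candidate w k≤m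
closureSearch-shortest w k (suc n) k≤m pal with candidate w k ≟W reverse (candidate w k)
... | yes _      = length-candidate w k≤m
... | no not-pal = closureSearch-shortest w (suc k) n (≤∧≢⇒< k≤m λ { refl → not-pal (sym pal) }) pal

palClosure-palindrome : ∀ u → Palindrome (palClosure u)
palClosure-palindrome u rewrite palClosure≡closureSearch u = closureSearch-palindrome u 0 (length u) refl

palClosure-extends : ∀ u → ∃ λ e → palClosure u ≡ u ++ e
palClosure-extends u rewrite palClosure≡closureSearch u = closureSearch-extends u 0 (length u)

palClosure-shortest : ∀ u s → Palindrome (u ++ s) → length (palClosure u) ≤ length (u ++ s)
palClosure-shortest u s pal rewrite palClosure≡closureSearch u | LP.length-++ u {s}
  with length s ≤? length u
... | yes s≤u = closureSearch-shortest u 0 (length u) z≤n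
                  (subst (λ t → Palindrome (u ++ t)) (palindrome-suffix-mirrors-prefix u s pal s≤u) pal)
... | no s≰u  = ≤-trans (closureSearch-shortest u 0 (length u) z≤n (palindrome-candidate-length u))
                        (+-monoʳ-≤ (length u) (<⇒≤ (≰⇒> s≰u)))

ψ-rev-palindrome : ∀ r → Palindrome (ψ-rev r)
ψ-rev-palindrome []      = refl
ψ-rev-palindrome (x ∷ r) = palClosure-palindrome (ψ-rev r ++ x ∷ [])

ψ-rev-∷ : ∀ x r → ∃ λ e → ψ-rev (x ∷ r) ≡ ψ-rev r ++ x ∷ e
ψ-rev-∷ x r with palClosure-extends (ψ-rev r ++ x ∷ [])
... | e , eq = e , trans eq (LP.++-assoc (ψ-rev r) (x ∷ []) e)

ψ-rev-∷-shortest : ∀ {x} r {e} z → ψ-rev (x ∷ r) ≡ ψ-rev r ++ x ∷ e →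
                   Palindrome (ψ-rev r ++ x ∷ z) → length e ≤ length z
ψ-rev-∷-shortest {x} r {e} z ext pal = s≤s⁻¹ (+-cancelˡ-≤ (length (ψ-rev r)) _ _ (begin
  length (ψ-rev r) + suc (length e)  ≡⟨ length-split (ψ-rev r) x e ext ⟨
  length (ψ-rev (x ∷ r))             ≤⟨ palClosure-shortest (ψ-rev r ++ x ∷ []) z
                                          (subst Palindrome (sym assoc) pal) ⟩
  length ((ψ-rev r ++ x ∷ []) ++ z)  ≡⟨ length-split (ψ-rev r) x z assoc ⟩
  length (ψ-rev r) + suc (length z)  ∎))
  where
  open ≤-Reasoning
  assoc = LP.++-assoc (ψ-rev r) (x ∷ []) z

ψ-rev-mono : ∀ t s → length (ψ-rev s) ≤ length (ψ-rev (t ++ s))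
ψ-rev-mono []      s = ≤-refl
ψ-rev-mono (x ∷ t) s with ψ-rev-∷ x (t ++ s)
... | e , ext = ≤-trans (ψ-rev-mono t s)
                        (≤-trans (LP.length-++-≤ˡ (ψ-rev (t ++ s))) (≤-reflexive (cong length (sym ext))))

ψ-rev-++-∷ : ∀ t y s → ∃ λ z → ψ-rev (t ++ y ∷ s) ≡ ψ-rev s ++ y ∷ z
ψ-rev-++-∷ []      y s = ψ-rev-∷ y s
ψ-rev-++-∷ (x ∷ t) y s with ψ-rev-++-∷ t y s | ψ-rev-∷ x (t ++ y ∷ s)
... | z , eq | e , ext = z ++ x ∷ e , (begin
  ψ-rev (x ∷ t ++ y ∷ s)      ≡⟨ ext ⟩
  ψ-rev (t ++ y ∷ s) ++ x ∷ e ≡⟨ cong (_++ x ∷ e) eq ⟩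
  (ψ-rev s ++ y ∷ z) ++ x ∷ e ≡⟨ LP.++-assoc (ψ-rev s) (y ∷ z) (x ∷ e) ⟩
  ψ-rev s ++ y ∷ z ++ x ∷ e   ∎)
  where open ≡-Reasoning

ψ-rev-palindromic-prefix : ∀ r {p z} → Palindrome p → ψ-rev r ≡ p ++ z →
  p ≡ ψ-rev r ⊎ ∃₂ λ t y → ∃ λ s → r ≡ t ++ y ∷ s × p ≡ ψ-rev s
ψ-rev-palindromic-prefix []      {[]}    _ _  = inj₁ refl
ψ-rev-palindromic-prefix []      {_ ∷ _} _ ()
ψ-rev-palindromic-prefix (x ∷ r) {p} {z} pal eq with ψ-rev-∷ x r | length p ≤? length (ψ-rev r)
... | e , ext | yes short with ++-≡⇒prefix (ψ-rev r) (x ∷ e) p z (trans (sym ext) eq) short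
...   | g , ψr≡ with ψ-rev-palindromic-prefix r pal ψr≡
...     | inj₁ p≡ψr                 = inj₂ ([] , x , r , refl , p≡ψr)
...     | inj₂ (t , y , s , r≡ , p≡) = inj₂ (x ∷ t , y , s , cong (x ∷_) r≡ , p≡)
-- A palindromic prefix longer than ψ-rev r extends ψ-rev r ++ [x], so by minimality it is ψ-rev (x ∷ r).
ψ-rev-palindromic-prefix (x ∷ r) {p} {z} pal eq | e , ext | no long
  with ++-≡⇒prefix p z (ψ-rev r ++ x ∷ []) e
         (trans (sym eq) (trans ext (sym (LP.++-assoc (ψ-rev r) (x ∷ []) e))))
         (≤-trans (≤-reflexive (trans (LP.length-++ (ψ-rev r)) (+-comm _ 1))) (≰⇒> long))
... | g , p≡ = inj₁ (sym (trans eq (trans (cong (p ++_) z≡[]) (LP.++-identityʳ p))))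
  where
  open ≤-Reasoning
  z≡[] : z ≡ []
  z≡[] = ++-length-≤⇒[] p (begin
    length (p ++ z)                    ≡⟨ cong length eq ⟨
    length (ψ-rev (x ∷ r))             ≤⟨ palClosure-shortest (ψ-rev r ++ x ∷ []) g (subst Palindrome p≡ pal) ⟩
    length ((ψ-rev r ++ x ∷ []) ++ g)  ≡⟨ cong length p≡ ⟨
    length p                           ∎)

ψ-rev-∷-short : ∀ {x r e} → ψ-rev (x ∷ r) ≡ ψ-rev r ++ x ∷ e → length e < length (ψ-rev r) →
                ∃₂ λ t s → r ≡ t ++ x ∷ s × ψ-rev r ≡ ψ-rev s ++ x ∷ e
ψ-rev-∷-short {x} {r} {e} ext lt
  with palindrome-short-extension x (ψ-rev-palindrome r)
         (subst Palindrome ext (ψ-rev-palindrome (x ∷ r))) lt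
... | g , palg , ψr≡ with ψ-rev-palindromic-prefix r palg ψr≡
...   | inj₁ refl = contradiction (LP.++-cancelˡ g [] (x ∷ e) (trans (LP.++-identityʳ g) ψr≡)) λ ()
...   | inj₂ (t , y , s , refl , refl) with ψ-rev-++-∷ t y s
...     | z , ψr≡′ with LP.∷-injective (LP.++-cancelˡ (ψ-rev s) (y ∷ z) (x ∷ e) (trans (sym ψr≡′) ψr≡))
...       | refl , refl = t , s , refl , ψr≡

ψ-rev-∷-length-fresh : ∀ {x r} → x ∉ r →
                       length (ψ-rev (x ∷ r)) ≡ length (ψ-rev r) + suc (length (ψ-rev r))
ψ-rev-∷-length-fresh {x} {r} x∉r with ψ-rev-∷ x r
... | e , ext = trans (length-split (ψ-rev r) x e ext) (cong (λ n → length (ψ-rev r) + suc n) e-length)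
  where
  not-shorter : ¬ length e < length (ψ-rev r)
  not-shorter lt with ψ-rev-∷-short ext lt
  ... | t , s , r≡ , _ = x∉r (subst (x ∈_) (sym r≡) (∈-++⁺ʳ t (here refl)))
  e-length : length e ≡ length (ψ-rev r)
  e-length = ≤-antisym (ψ-rev-∷-shortest r (ψ-rev r) ext (palindrome-mirror x (ψ-rev-palindrome r)))
                       (≮⇒≥ not-shorter)

ψ-rev-∷-length-repeated : ∀ {x} t s {z} → x ∉ t → ψ-rev (t ++ x ∷ s) ≡ ψ-rev s ++ x ∷ z →
  length (ψ-rev (x ∷ t ++ x ∷ s)) ≡ length (ψ-rev (t ++ x ∷ s)) + suc (length z)
ψ-rev-∷-length-repeated {x} t s {z} x∉t ψr≡ with ψ-rev-∷ x (t ++ x ∷ s)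
... | e , ext = trans (length-split (ψ-rev r) x e ext) (cong (λ n → length (ψ-rev r) + suc n) e-length)
  where
  r = t ++ x ∷ s
  open ≤-Reasoning
  z≤ψr : length z ≤ length (ψ-rev r)
  z≤ψr = ≤-trans (n≤1+n (length z))
                 (≤-trans (LP.length-++-≤ʳ (x ∷ z) {ψ-rev s}) (≤-reflexive (cong length (sym ψr≡))))
  -- A shorter e would come from a later occurrence of x, whose ψ-rev is no longer.
  not-shorter : ¬ length e < length z
  not-shorter e<z with ψ-rev-∷-short ext (<-≤-trans e<z z≤ψr)
  ... | t′ , s′ , r≡ , ψr≡′ with ∉-suffix-of-first t t′ x∉t r≡
  ... | u , refl = <-irrefl refl (begin-strict
    length (ψ-rev r)                   ≡⟨ length-split (ψ-rev s′) x e ψr≡′ ⟩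
    length (ψ-rev s′) + suc (length e) ≤⟨ +-monoˡ-≤ (suc (length e)) (ψ-rev-mono u s′) ⟩
    length (ψ-rev s) + suc (length e)  <⟨ +-monoʳ-< (length (ψ-rev s)) (s≤s e<z) ⟩
    length (ψ-rev s) + suc (length z)  ≡⟨ length-split (ψ-rev s) x z ψr≡ ⟨
    length (ψ-rev r)                   ∎)
  e-length : length e ≡ length z
  e-length = ≤-antisym (ψ-rev-∷-shortest r z ext
                          (subst (λ q → Palindrome (q ++ x ∷ z)) (sym ψr≡)
                            (palindrome-repeat x (ψ-rev-palindrome s)
                              (subst Palindrome ψr≡ (ψ-rev-palindrome r)))))
                       (≮⇒≥ not-shorter)

size : Word → ℕ
size r = length (ψ-rev r) + 2

-- For r = reverse v: |ψ v′| + 2 where v = v′ x v″ with x ∉ v″, and 1 (as if |ψ v′| = -1) when x ∉ v.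
sizeAfterFirst : Letter → Word → ℕ
sizeAfterFirst x []      = 1
sizeAfterFirst x (y ∷ r) = if does (x ≟L y) then size r else sizeAfterFirst x r

first-occurrence : ∀ x r →
  (∃₂ λ t s → r ≡ t ++ x ∷ s × x ∉ t × sizeAfterFirst x r ≡ size s) ⊎ (x ∉ r × sizeAfterFirst x r ≡ 1)
first-occurrence x []      = inj₂ ((λ ()) , refl)
first-occurrence x (y ∷ r) with x ≟L y
... | yes refl = inj₁ ([] , r , refl , (λ ()) , refl)
... | no x≢y with first-occurrence x r
...   | inj₁ (t , s , refl , x∉t , after≡) = inj₁ (y ∷ t , s , refl , ∉-∷⁺ x≢y x∉t , after≡)
...   | inj₂ (x∉r , after≡) = inj₂ (∉-∷⁺ x≢y x∉r , after≡)

size-∷ : ∀ x r → size (x ∷ r) + sizeAfterFirst x r ≡ size r + size r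
size-∷ x r with first-occurrence x r
... | inj₁ (t , s , refl , x∉t , after≡) with ψ-rev-++-∷ t x s
...   | z , ψr≡ rewrite after≡ =
  repeated (ψ-rev-∷-length-repeated t s x∉t ψr≡) (length-split (ψ-rev s) x z ψr≡)
  where
  repeated : ∀ {c w s z} → c ≡ w + suc z → w ≡ s + suc z → (c + 2) + (s + 2) ≡ (w + 2) + (w + 2)
  repeated {s = s} {z} refl refl = solve (s ∷ z ∷ [])
size-∷ x r | inj₂ (x∉r , after≡) rewrite after≡ = fresh (ψ-rev-∷-length-fresh x∉r)
  where
  fresh : ∀ {c w} → c ≡ w + suc w → (c + 2) + 1 ≡ (w + 2) + (w + 2)
  fresh {w = w} refl = solve (w ∷ [])

size-∷-complement : ∀ x r {B} → size r ≡ sizeAfterFirst x r + B → size (x ∷ r) ≡ size r + B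
size-∷-complement x r {B} split = +-cancelʳ-≡ A (size (x ∷ r)) (size r + B) (begin
  size (x ∷ r) + A     ≡⟨ size-∷ x r ⟩
  size r + size r      ≡⟨ cong (size r +_) split ⟩
  size r + (A + B)     ≡⟨ cong (size r +_) (+-comm A B) ⟩
  size r + (B + A)     ≡⟨ +-assoc (size r) B A ⟨
  size r + B + A       ∎)
  where
  open ≡-Reasoning
  A = sizeAfterFirst x r

size-split : ∀ r → size r ≡ sizeAfterFirst a r + sizeAfterFirst b r
size-split []      = refl
size-split (a ∷ r) = size-∷-complement a r (size-split r)
size-split (b ∷ r) =
  trans (size-∷-complement b r (trans (size-split r) (+-comm (sizeAfterFirst a r) _))) (+-comm (size r) _)

step : Letter → ℕ × ℕ → ℕ × ℕ
step a (A , B) = A , A + B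
step b (A , B) = A + B , B

total : ℕ × ℕ → ℕ
total (A , B) = A + B

foldr-step-sizes : ∀ r → foldr step (1 , 1) r ≡ (sizeAfterFirst b r , sizeAfterFirst a r)
foldr-step-sizes []      = refl
foldr-step-sizes (a ∷ r) rewrite foldr-step-sizes r | size-split r =
  cong (sizeAfterFirst b r ,_) (+-comm (sizeAfterFirst b r) _)
foldr-step-sizes (b ∷ r) rewrite foldr-step-sizes r | size-split r =
  cong (_, sizeAfterFirst a r) (+-comm (sizeAfterFirst b r) _)

score : ℕ → ℕ → Word → ℕ
score A B w = total (foldl (flip step) (A , B) w)

length-ψ : ∀ v → length (ψ v) + 2 ≡ score 1 1 v
length-ψ v = begin
  size r                                          ≡⟨ size-split r ⟩
  sizeAfterFirst a r + sizeAfterFirst b r         ≡⟨ +-comm (sizeAfterFirst a r) _ ⟩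
  total (sizeAfterFirst b r , sizeAfterFirst a r) ≡⟨ cong total (foldr-step-sizes r) ⟨
  total (foldr step (1 , 1) r)                    ≡⟨ cong total (LP.reverse-foldr step (1 , 1) v) ⟩
  total (foldl (flip step) (1 , 1) v)             ∎
  where
  open ≡-Reasoning
  r = reverse v

score-monoˡ-< : ∀ w {A A′ B B′} → A < A′ → B ≤ B′ → score A B w < score A′ B′ w
score-monoˡ-< []      A< B≤ = +-mono-<-≤ A< B≤
score-monoˡ-< (a ∷ w) A< B≤ = score-monoˡ-< w A< (+-mono-≤ (<⇒≤ A<) B≤)
score-monoˡ-< (b ∷ w) A< B≤ = score-monoˡ-< w (+-mono-<-≤ A< B≤) B≤

score-E : ∀ w A B → score A B w ≡ score B A (E w)
score-E []      A B = +-comm A B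
score-E (a ∷ w) A B = trans (score-E w A (A + B)) (cong (λ C → score C A (E w)) (+-comm A B))
score-E (b ∷ w) A B = trans (score-E w (A + B) B) (cong (λ C → score B C (E w)) (+-comm A B))

E-altFrom : ∀ x n → E (altFrom x n) ≡ altFrom (swapL x) n
E-altFrom x zero    = refl
E-altFrom a (suc n) = cong (b ∷_) (E-altFrom b n)
E-altFrom b (suc n) = cong (a ∷_) (E-altFrom a n)

Dominates : ℕ → ℕ → Word → Word → Set
Dominates A B u w = score A B w ≤ score A B u × (score A B w ≡ score A B u → w ≡ u)

mutual
  altFrom-b-dominates : ∀ w {A B} → 1 ≤ A → A < B → Dominates A B (altFrom b (length w)) w
  altFrom-b-dominates []      _   _   = ≤-refl , λ _ → refl
  altFrom-b-dominates (b ∷ w) {A} {B} 1≤A A<B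
    with altFrom-a-dominates w {A + B} {B} (≤-trans 1≤A (<⇒≤ A<B)) (m<n+m B 1≤A)
  ... | le , unique = le , λ eq → cong (b ∷_) (unique eq)
  altFrom-b-dominates (a ∷ w) {A} {B} 1≤A A<B
    with altFrom-b-dominates w {A} {A + B} 1≤A (m<m+n A (<-≤-trans 1≤A (<⇒≤ A<B)))
  ... | le , _ = ≤-trans le (<⇒≤ gap) , λ eq → contradiction eq (<⇒≢ (≤-<-trans le gap))
    where
    k = length w
    gap : score A (A + B) (altFrom b k) < score (A + B) B (altFrom a k)
    gap = begin-strict
      score A (A + B) (altFrom b k)      <⟨ score-monoˡ-< (altFrom b k) A<B ≤-refl ⟩
      score B (A + B) (altFrom b k)      ≡⟨ cong (score B (A + B)) (E-altFrom a k) ⟨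
      score B (A + B) (E (altFrom a k))  ≡⟨ score-E (altFrom a k) (A + B) B ⟨
      score (A + B) B (altFrom a k)      ∎
      where open ≤-Reasoning

  altFrom-a-dominates : ∀ w {A B} → 1 ≤ B → B < A → Dominates A B (altFrom a (length w)) w
  altFrom-a-dominates []      _   _   = ≤-refl , λ _ → refl
  altFrom-a-dominates (a ∷ w) {A} {B} 1≤B B<A
    with altFrom-b-dominates w {A} {A + B} (≤-trans 1≤B (<⇒≤ B<A)) (m<m+n A 1≤B)
  ... | le , unique = le , λ eq → cong (a ∷_) (unique eq)
  altFrom-a-dominates (b ∷ w) {A} {B} 1≤B B<A
    with altFrom-a-dominates w {A + B} {B} 1≤B (m<n+m B (<-≤-trans 1≤B (<⇒≤ B<A)))
  ... | le , _ = ≤-trans le (<⇒≤ gap) , λ eq → contradiction eq (<⇒≢ (≤-<-trans le gap))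
    where
    k = length w
    gap : score (A + B) B (altFrom a k) < score A (A + B) (altFrom b k)
    gap = begin-strict
      score (A + B) B (altFrom a k)      ≡⟨ score-E (altFrom a k) (A + B) B ⟩
      score B (A + B) (E (altFrom a k))  ≡⟨ cong (score B (A + B)) (E-altFrom a k) ⟩
      score B (A + B) (altFrom b k)      <⟨ score-monoˡ-< (altFrom b k) B<A ≤-refl ⟩
      score A (A + B) (altFrom b k)      ∎
      where open ≤-Reasoning

vpref-maximises-score : ∀ v →
  score 1 1 v ≤ score 1 1 (vpref (length v)) ×
  (score 1 1 v ≡ score 1 1 (vpref (length v)) → v ≡ vpref (length v) ⊎ v ≡ E (vpref (length v)))
vpref-maximises-score []      = ≤-refl , λ _ → inj₁ refl
vpref-maximises-score (a ∷ w) with altFrom-b-dominates w {1} {2} ≤-refl ≤-refl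
... | le , unique = le , λ eq → inj₁ (cong (a ∷_) (unique eq))
vpref-maximises-score (b ∷ w) with altFrom-a-dominates w {2} {1} ≤-refl ≤-refl
... | le , unique = ≤-trans le (≤-reflexive mirror) ,
                    λ eq → inj₂ (cong (b ∷_) (trans (unique (trans eq (sym mirror))) (sym (E-altFrom b k))))
  where
  k = length w
  mirror : score 2 1 (altFrom a k) ≡ score 1 2 (altFrom b k)
  mirror = trans (score-E (altFrom a k) 2 1) (cong (score 1 2) (E-altFrom a k))

length-ψ-E : ∀ u → length (ψ (E u)) ≡ length (ψ u)
length-ψ-E u =
  +-cancelʳ-≡ 2 _ _ (trans (length-ψ (E u)) (trans (sym (score-E u 1 1)) (sym (length-ψ u))))

theorem4p1 : (n : ℕ) (v : Word) → length v ≡ n →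
    (length (ψ v) ≤ length (ψ (vpref n)))
      × ((length (ψ v) ≡ length (ψ (vpref n))) ⇔ (v ≡ vpref n ⊎ v ≡ E (vpref n)))
theorem4p1 .(length v) v refl with vpref-maximises-score v
... | le , unique =
  +-cancelʳ-≤ 2 _ _ (subst₂ _≤_ (sym (length-ψ v)) (sym (length-ψ u)) le) ,
  mk⇔ (λ eq → unique (trans (sym (length-ψ v)) (trans (cong (_+ 2) eq) (length-ψ u))))
      λ { (inj₁ v≡u)  → cong (length ∘ ψ) v≡u
        ; (inj₂ v≡Eu) → trans (cong (length ∘ ψ) v≡Eu) (length-ψ-E u) }
  where
  u = vpref (length v)
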